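{- Let $G_1$ be a simple connected $r_1$-regular graph on $n_1$ vertices and $G_2$ a simple connected $r_2$-regular graph on $n_2$ vertices, and let $G=G_1\vee G_2$. Then the $Q$-coronal of $G$ is, as a rational function of $\lambda$, \[ \Gamma _Q (\lambda ) = \frac{(\lambda - n_2 - 2r_1 )n_2 + (\lambda - n_1 - 2r_2 )n_1 + 2n_1 n_2 }{(\lambda - n_2 - 2r_1 )(\lambda - n_1 - 2r_2 ) - n_1 n_2 }. \]
   Context: The join $G_1\vee G_2$ of graphs with disjoint vertex sets is their disjoint union together with all edges joining a vertex of $G_1$ to a vertex of $G_2$. For a graph $G$ of order $n$ with signless Laplacian $Q(G)=D(G)+A(G)$ (degree diagonal matrix plus adjacency matrix), the $Q$-coronal is $\Gamma_Q(\lambda)=\mathbf{1}_n^T(\lambda I_n-Q(G))^{ -1}\mathbf{1}_n$, the sum of all entries of $(\lambda I_n-Q(G))^{ -1}$. -}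

module Defs where

open import Data.Nat using (ℕ; zero; suc; _+_)
open import Data.Bool using (Bool; true; false; if_then_else_)
open import Data.Fin using (Fin; zero; suc; splitAt; _≟_)
open import Data.Sum using (_⊎_; inj₁; inj₂)
open import Data.Product using (_×_)
open import Data.Rational using (ℚ; 0ℚ; 1ℚ) renaming (_+_ to _+ℚ_; _-_ to _-ℚ_; _*_ to _*ℚ_)
import Data.Rational as ℚ
import Data.Integer as ℤ
open import Relation.Nullary using (yes; no; ¬_)
open import Relation.Binary.PropositionalEquality using (_≡_)

record Graph (n : ℕ) : Set where
  field
    adj       : Fin n → Fin n → Bool
    symmetric : ∀ i j → adj i j ≡ adj j i
    loopless  : ∀ i → adj i i ≡ false
open Graph public

sumFin : ∀ {A : Set} → A → (A → A → A) → ∀ n → (Fin n → A) → A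
sumFin z _⊕_ zero    f = z
sumFin z _⊕_ (suc n) f = f zero ⊕ sumFin z _⊕_ n (λ i → f (suc i))

Σℚ : ∀ n → (Fin n → ℚ) → ℚ
Σℚ = sumFin 0ℚ _+ℚ_

degree : ∀ {n} → Graph n → Fin n → ℕ
degree {n} G i = sumFin 0 _+_ n (λ j → if adj G i j then 1 else 0)

Regular : ∀ {n} → Graph n → ℕ → Set
Regular G r = ∀ i → degree G i ≡ r

data Reachable {n} (G : Graph n) : Fin n → Fin n → Set where
  here : ∀ {i} → Reachable G i i
  step : ∀ {i j k} → adj G i j ≡ true → Reachable G j k → Reachable G i k

Connected : ∀ {n} → Graph n → Set
Connected {n} G = Fin n × (∀ i j → Reachable G i j)

joinAdj : ∀ {n₁ n₂} → Graph n₁ → Graph n₂ → Fin (n₁ + n₂) → Fin (n₁ + n₂) → Bool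
joinAdj {n₁} G₁ G₂ i j with splitAt n₁ i | splitAt n₁ j
... | inj₁ a | inj₁ b = adj G₁ a b
... | inj₂ a | inj₂ b = adj G₂ a b
... | inj₁ _ | inj₂ _ = true
... | inj₂ _ | inj₁ _ = true

private
  joinSym : ∀ {n₁ n₂} (G₁ : Graph n₁) (G₂ : Graph n₂) i j →
            joinAdj G₁ G₂ i j ≡ joinAdj G₁ G₂ j i
  joinSym {n₁} G₁ G₂ i j with splitAt n₁ i | splitAt n₁ j
  ... | inj₁ a | inj₁ b = symmetric G₁ a b
  ... | inj₂ a | inj₂ b = symmetric G₂ a b
  ... | inj₁ _ | inj₂ _ = Relation.Binary.PropositionalEquality.refl
  ... | inj₂ _ | inj₁ _ = Relation.Binary.PropositionalEquality.refl

  joinLoop : ∀ {n₁ n₂} (G₁ : Graph n₁) (G₂ : Graph n₂) i → joinAdj G₁ G₂ i i ≡ false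
  joinLoop {n₁} G₁ G₂ i with splitAt n₁ i
  ... | inj₁ a = loopless G₁ a
  ... | inj₂ a = loopless G₂ a

_∨G_ : ∀ {n₁ n₂} → Graph n₁ → Graph n₂ → Graph (n₁ + n₂)
G₁ ∨G G₂ = record { adj = joinAdj G₁ G₂ ; symmetric = joinSym G₁ G₂ ; loopless = joinLoop G₁ G₂ }

Matrix : ℕ → Set
Matrix n = Fin n → Fin n → ℚ

ℕtoℚ : ℕ → ℚ
ℕtoℚ k = (ℤ.+ k) ℚ./ 1

boolℚ : Bool → ℚ
boolℚ true  = 1ℚ
boolℚ false = 0ℚ

δ : ∀ {n} → Fin n → Fin n → ℚ
δ i j with i ≟ j
... | yes _ = 1ℚ
... | no  _ = 0ℚ

signlessLaplacian : ∀ {n} → Graph n → Matrix n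
signlessLaplacian G i j = (δ i j *ℚ ℕtoℚ (degree G i)) +ℚ boolℚ (adj G i j)

_⊗_ : ∀ {n} → Matrix n → Matrix n → Matrix n
_⊗_ {n} M N i j = Σℚ n (λ k → M i k *ℚ N k j)

identity : ∀ {n} → Matrix n
identity = δ

shiftedQ : ∀ {n} → Graph n → ℚ → Matrix n
shiftedQ G λ' i j = (λ' *ℚ δ i j) -ℚ signlessLaplacian G i j

IsInverse : ∀ {n} → Matrix n → Matrix n → Set
IsInverse M N = (∀ i j → (M ⊗ N) i j ≡ identity i j) × (∀ i j → (N ⊗ M) i j ≡ identity i j)

entrySum : ∀ {n} → Matrix n → ℚ
entrySum {n} M = Σℚ n (λ i → Σℚ n (λ j → M i j))

-- The vectors that are constant on each side of the join form a subspace invariant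
-- under Q(G₁ ∨ G₂): a vertex of G₁ has r₁ neighbours in G₁ and n₂ in G₂, so λI − Q maps
-- the block vector (p, q) to (a p − n₂ q, b q − n₁ p), where a = λ − n₂ − 2r₁ and
-- b = λ − n₁ − 2r₂.  Hence λI − Q sends (b + n₂, a + n₁) to den·𝟙, and applying the
-- inverse M gives den·M𝟙 = (b + n₂, a + n₁), whose entry sum is num.  λI − Q also sends
-- (n₂, a) to (0, den), so den = 0 would force (n₂, a) = M·0 = 0, impossible as G₂ is
-- nonempty.  Connectedness is only used for nonemptiness, and only M(λI − Q) = I is needed.

module Submission where

open import Defs
open import Algebra.Bundles using (CommutativeRing)
open import Data.Bool using (Bool; true; false; if_then_else_)
open import Data.Fin using (Fin; zero; suc; splitAt; _↑ˡ_; _↑ʳ_; _≟_)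
open import Data.Fin.Properties using (splitAt-↑ˡ; splitAt-↑ʳ; splitAt⁻¹-↑ˡ; splitAt⁻¹-↑ʳ)
import Data.Integer as ℤ
import Data.Integer.Properties as ℤ
open import Data.Nat using (ℕ; zero; suc) renaming (_+_ to _+ℕ_)
open import Data.Product using (_×_; _,_)
open import Data.Rational using (ℚ; 0ℚ; 1ℚ; _+_; _-_; _*_; -_; toℚᵘ)
open import Data.Rational.Properties
  using ( +-*-commutativeRing; +-identityˡ; +-identityʳ; +-assoc; *-assoc
        ; *-zeroˡ; *-zeroʳ; *-identityˡ; *-identityʳ; *-distribʳ-+
        ; toℚᵘ-injective; toℚᵘ-fromℚᵘ; toℚᵘ-homo-+; toℚᵘ-cong)
  renaming (_≟_ to _≟ℚ_)
import Data.Rational.Unnormalised as ℚᵘ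
import Data.Rational.Unnormalised.Properties as ℚᵘ
open import Data.Sum using (inj₁; inj₂)
open import Data.Vec.Functional using (Vector; replicate; _++_)
open import Data.Vec.Functional.Properties using (lookup-++ˡ; lookup-++ʳ)
open import Function using (_∘_)
open import Level using (0ℓ)
open import Relation.Binary.PropositionalEquality
open import Relation.Nullary using (yes; no)
open import Relation.Nullary.Decidable.Core using (dec⇒maybe)
open import Tactic.RingSolver using (solve-∀)
open import Tactic.RingSolver.Core.AlmostCommutativeRing
  using (AlmostCommutativeRing; fromCommutativeRing)

open import Algebra.Properties.Semiring.Sum (CommutativeRing.semiring +-*-commutativeRing)
  using (sum; sum-syntax; sum-cong-≗; sum-replicate-zero; ∑-distrib-+; ∑-comm
        ; *-distribˡ-sum; *-distribʳ-sum)

ℚ-ring : AlmostCommutativeRing 0ℓ 0ℓ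
ℚ-ring = fromCommutativeRing +-*-commutativeRing (λ x → dec⇒maybe (0ℚ ≟ℚ x))

-- ℕtoℚ k is fromℚᵘ (k / 1), so this is checked in ℚᵘ, where addition does not normalise.
ℕtoℚ-suc : ∀ k → ℕtoℚ (suc k) ≡ 1ℚ + ℕtoℚ k
ℕtoℚ-suc k = toℚᵘ-injective (begin
  toℚᵘ (ℕtoℚ (suc k))            ≈⟨ toℚᵘ-fromℚᵘ (ℚᵘ.mkℚᵘ (ℤ.+ suc k) 0) ⟩
  ℚᵘ.mkℚᵘ (ℤ.+ suc k) 0          ≈⟨ ℚᵘ.*≡* (trans (ℤ.*-identityʳ (ℤ.+ suc k))
                                      (sym (trans (ℤ.*-identityʳ _) (cong (ℤ._+_ ℤ.1ℤ) (ℤ.*-identityʳ (ℤ.+ k)))))) ⟩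
  ℚᵘ.1ℚᵘ ℚᵘ.+ ℚᵘ.mkℚᵘ (ℤ.+ k) 0  ≈⟨ ℚᵘ.+-congʳ ℚᵘ.1ℚᵘ (ℚᵘ.≃-sym (toℚᵘ-fromℚᵘ (ℚᵘ.mkℚᵘ (ℤ.+ k) 0))) ⟩
  toℚᵘ 1ℚ ℚᵘ.+ toℚᵘ (ℕtoℚ k)      ≈⟨ ℚᵘ.≃-sym (toℚᵘ-homo-+ 1ℚ (ℕtoℚ k)) ⟩
  toℚᵘ (1ℚ + ℕtoℚ k)              ∎)
  where open ℚᵘ.≃-Reasoning

ℕtoℚ≢0 : ∀ {n} → Fin n → ℕtoℚ n ≢ 0ℚ
ℕtoℚ≢0 {suc k} _ eq with ℚᵘ.≃-trans (ℚᵘ.≃-sym (toℚᵘ-fromℚᵘ (ℚᵘ.mkℚᵘ (ℤ.+ suc k) 0))) (toℚᵘ-cong eq)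
... | ℚᵘ.*≡* ()

Σℚ≡sum : ∀ n (f : Vector ℚ n) → Σℚ n f ≡ sum f
Σℚ≡sum zero    f = refl
Σℚ≡sum (suc n) f = cong (f zero +_) (Σℚ≡sum n (f ∘ suc))

sum-replicate-ℕtoℚ : ∀ n c → sum (replicate n c) ≡ ℕtoℚ n * c
sum-replicate-ℕtoℚ zero    c = sym (*-zeroˡ c)
sum-replicate-ℕtoℚ (suc n) c = begin
  c + sum (replicate n c)  ≡⟨ cong₂ _+_ (sym (*-identityˡ c)) (sum-replicate-ℕtoℚ n c) ⟩
  1ℚ * c + ℕtoℚ n * c      ≡⟨ sym (*-distribʳ-+ c 1ℚ (ℕtoℚ n)) ⟩
  (1ℚ + ℕtoℚ n) * c        ≡⟨ cong (_* c) (sym (ℕtoℚ-suc n)) ⟩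
  ℕtoℚ (suc n) * c         ∎
  where open ≡-Reasoning

sum-boolℚ : ∀ n (b : Fin n → Bool) →
            sum (boolℚ ∘ b) ≡ ℕtoℚ (sumFin 0 _+ℕ_ n (λ j → if b j then 1 else 0))
sum-boolℚ zero    b = refl
sum-boolℚ (suc n) b with b zero
... | true  = trans (cong (1ℚ +_) (sum-boolℚ n (b ∘ suc)))
                    (sym (ℕtoℚ-suc (sumFin 0 _+ℕ_ n (λ j → if b (suc j) then 1 else 0))))
... | false = trans (+-identityˡ _) (sum-boolℚ n (b ∘ suc))

sum-↑ : ∀ m {n} (f : Vector ℚ (m +ℕ n)) →
        sum f ≡ sum (f ∘ (_↑ˡ n)) + sum (f ∘ (m ↑ʳ_))
sum-↑ zero    f = sym (+-identityˡ (sum f))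
sum-↑ (suc m) f = trans (cong (f zero +_) (sum-↑ m (f ∘ suc))) (sym (+-assoc (f zero) _ _))

≗-++ : ∀ {A : Set} {m n} {u : Vector A (m +ℕ n)} {x : Vector A m} {y : Vector A n} →
       (∀ i → u (i ↑ˡ n) ≡ x i) → (∀ j → u (m ↑ʳ j) ≡ y j) → u ≗ x ++ y
≗-++ {m = m} {u = u} {x} {y} left right k with splitAt m k in eq
... | inj₁ i = subst (λ k → u k ≡ x i) (splitAt⁻¹-↑ˡ eq) (left i)
... | inj₂ j = subst (λ k → u k ≡ y j) (splitAt⁻¹-↑ʳ eq) (right j)

infix 7 _∙_ _·_

_∙_ : ∀ {n} → Vector ℚ n → Vector ℚ n → ℚ
u ∙ v = sum (λ j → u j * v j)

_·_ : ∀ {n} → Matrix n → Vector ℚ n → Vector ℚ n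
(M · v) i = M i ∙ v

∙-congʳ : ∀ {n} {u u′ : Vector ℚ n} (v : Vector ℚ n) → u ≗ u′ → u ∙ v ≡ u′ ∙ v
∙-congʳ v u≗u′ = sum-cong-≗ (λ j → cong (_* v j) (u≗u′ j))

∙-congˡ : ∀ {n} (u : Vector ℚ n) {v v′ : Vector ℚ n} → v ≗ v′ → u ∙ v ≡ u ∙ v′
∙-congˡ u v≗v′ = sum-cong-≗ (λ j → cong (u j *_) (v≗v′ j))

∙-++ : ∀ {m n} (u u′ : Vector ℚ m) (w w′ : Vector ℚ n) →
       (u ++ w) ∙ (u′ ++ w′) ≡ u ∙ u′ + w ∙ w′
∙-++ {m} u u′ w w′ = trans (sum-↑ m _) (cong₂ _+_
  (sum-cong-≗ (λ i → cong₂ _*_ (lookup-++ˡ u w i) (lookup-++ˡ u′ w′ i)))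
  (sum-cong-≗ (λ j → cong₂ _*_ (lookup-++ʳ u w j) (lookup-++ʳ u′ w′ j))))

∙-replicate : ∀ {n} (u : Vector ℚ n) c → u ∙ replicate n c ≡ sum u * c
∙-replicate u c = sym (*-distribʳ-sum c u)

sum-·-replicate : ∀ {n} (M : Matrix n) c → sum (M · replicate n c) ≡ entrySum M * c
sum-·-replicate {n} M c = begin
  sum (M · replicate n c)           ≡⟨ sum-cong-≗ (λ i → ∙-replicate (M i) c) ⟩
  ∑[ i < n ] (sum (M i) * c)        ≡⟨ sym (*-distribʳ-sum c (sum ∘ M)) ⟩
  ∑[ i < n ] sum (M i) * c          ≡⟨ cong (_* c) (sym (trans (Σℚ≡sum n _) (sum-cong-≗ (λ i → Σℚ≡sum n (M i))))) ⟩
  entrySum M * c                    ∎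
  where open ≡-Reasoning

δ-suc : ∀ {n} (i j : Fin n) → δ (suc i) (suc j) ≡ δ i j
δ-suc i j with i ≟ j
... | yes _ = refl
... | no  _ = refl

identity-· : ∀ {n} (v : Vector ℚ n) → identity · v ≗ v
identity-· {suc n} v zero = begin
  1ℚ * v zero + ∑[ j < n ] (0ℚ * v (suc j))
    ≡⟨ cong₂ _+_ (*-identityˡ (v zero)) (sum-cong-≗ (λ j → *-zeroˡ (v (suc j)))) ⟩
  v zero + ∑[ j < n ] 0ℚ                     ≡⟨ cong (v zero +_) (sum-replicate-zero n) ⟩
  v zero + 0ℚ                                ≡⟨ +-identityʳ (v zero) ⟩
  v zero                                     ∎
  where open ≡-Reasoning
identity-· {suc n} v (suc i) = begin
  0ℚ * v zero + ∑[ j < n ] (δ (suc i) (suc j) * v (suc j))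
    ≡⟨ cong₂ _+_ (*-zeroˡ (v zero)) (sum-cong-≗ (λ j → cong (_* v (suc j)) (δ-suc i j))) ⟩
  0ℚ + (identity · (v ∘ suc)) i  ≡⟨ +-identityˡ _ ⟩
  (identity · (v ∘ suc)) i       ≡⟨ identity-· (v ∘ suc) i ⟩
  v (suc i)                      ∎
  where open ≡-Reasoning

·-assoc : ∀ {n} (M N : Matrix n) (v : Vector ℚ n) → (M ⊗ N) · v ≗ M · (N · v)
·-assoc {n} M N v i = begin
  ∑[ j < n ] (Σℚ n (λ k → M i k * N k j) * v j)  ≡⟨ sum-cong-≗ (λ j → cong (_* v j) (Σℚ≡sum n _)) ⟩
  ∑[ j < n ] (∑[ k < n ] (M i k * N k j) * v j)  ≡⟨ sum-cong-≗ (λ j → *-distribʳ-sum (v j) (λ k → M i k * N k j)) ⟩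
  ∑[ j < n ] ∑[ k < n ] (M i k * N k j * v j)    ≡⟨ ∑-comm (λ j k → M i k * N k j * v j) ⟩
  ∑[ k < n ] ∑[ j < n ] (M i k * N k j * v j)    ≡⟨ sum-cong-≗ (λ k → sum-cong-≗ (λ j → *-assoc (M i k) (N k j) (v j))) ⟩
  ∑[ k < n ] ∑[ j < n ] (M i k * (N k j * v j))  ≡⟨ sum-cong-≗ (λ k → sym (*-distribˡ-sum (M i k) (λ j → N k j * v j))) ⟩
  ∑[ k < n ] (M i k * (N · v) k)                 ∎
  where open ≡-Reasoning

inverse-solves : ∀ {n} {M N : Matrix n} → (∀ i j → (M ⊗ N) i j ≡ identity i j) →
                 ∀ {u w} → N · u ≗ w → u ≗ M · w
inverse-solves {M = M} {N} M⊗N≡I {u} {w} N·u≗w i = begin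
  u i                ≡⟨ sym (identity-· u i) ⟩
  (identity · u) i   ≡⟨ ∙-congʳ u (λ j → sym (M⊗N≡I i j)) ⟩
  ((M ⊗ N) · u) i    ≡⟨ ·-assoc M N u i ⟩
  (M · (N · u)) i    ≡⟨ ∙-congˡ (M i) N·u≗w ⟩
  (M · w) i          ∎
  where open ≡-Reasoning

adjacency : ∀ {n} → Graph n → Matrix n
adjacency G i j = boolℚ (adj G i j)

degree≡sum-adjacency : ∀ {n} (G : Graph n) i → ℕtoℚ (degree G i) ≡ sum (adjacency G i)
degree≡sum-adjacency {n} G i = sym (sum-boolℚ n (adj G i))

degree-∙-ones : ∀ {n} (G : Graph n) i → ℕtoℚ (degree G i) ≡ adjacency G i ∙ replicate n 1ℚ
degree-∙-ones G i = begin
  ℕtoℚ (degree G i)               ≡⟨ sym (*-identityʳ _) ⟩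
  ℕtoℚ (degree G i) * 1ℚ          ≡⟨ cong (_* 1ℚ) (degree≡sum-adjacency G i) ⟩
  sum (adjacency G i) * 1ℚ        ≡⟨ sym (∙-replicate (adjacency G i) 1ℚ) ⟩
  adjacency G i ∙ replicate _ 1ℚ  ∎
  where open ≡-Reasoning

regular-∙-replicate : ∀ {n r} (G : Graph n) → Regular G r →
                      ∀ i c → adjacency G i ∙ replicate n c ≡ ℕtoℚ r * c
regular-∙-replicate {r = r} G reg i c = begin
  adjacency G i ∙ replicate _ c  ≡⟨ ∙-replicate (adjacency G i) c ⟩
  sum (adjacency G i) * c        ≡⟨ cong (_* c) (sym (degree≡sum-adjacency G i)) ⟩
  ℕtoℚ (degree G i) * c          ≡⟨ cong (λ d → ℕtoℚ d * c) (reg i) ⟩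
  ℕtoℚ r * c                     ∎
  where open ≡-Reasoning

ones-∙-replicate : ∀ n c → replicate n 1ℚ ∙ replicate n c ≡ ℕtoℚ n * c
ones-∙-replicate n c = trans (sum-cong-≗ {n} (λ _ → *-identityˡ c)) (sum-replicate-ℕtoℚ n c)

shiftedQ-· : ∀ {n} (G : Graph n) λ' (v : Vector ℚ n) {i d x s} →
             ℕtoℚ (degree G i) ≡ d → v i ≡ x → adjacency G i ∙ v ≡ s →
             (shiftedQ G λ' · v) i ≡ (λ' - d) * x - s
shiftedQ-· {n} G λ' v {i} refl refl refl = begin
  ∑[ j < n ] ((λ' * δ i j - (δ i j * d + A j)) * v j)
    ≡⟨ sum-cong-≗ (λ j → unfold-entry λ' (δ i j) d (A j) (v j)) ⟩
  ∑[ j < n ] ((λ' - d) * (δ i j * v j) + (- 1ℚ) * (A j * v j))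
    ≡⟨ ∑-distrib-+ (λ j → (λ' - d) * (δ i j * v j)) (λ j → (- 1ℚ) * (A j * v j)) ⟩
  ∑[ j < n ] ((λ' - d) * (δ i j * v j)) + ∑[ j < n ] ((- 1ℚ) * (A j * v j))
    ≡⟨ sym (cong₂ _+_ (*-distribˡ-sum (λ' - d) (λ j → δ i j * v j)) (*-distribˡ-sum (- 1ℚ) (λ j → A j * v j))) ⟩
  (λ' - d) * (identity · v) i + (- 1ℚ) * (A ∙ v)
    ≡⟨ cong (λ x → (λ' - d) * x + (- 1ℚ) * (A ∙ v)) (identity-· v i) ⟩
  (λ' - d) * v i + (- 1ℚ) * (A ∙ v)
    ≡⟨ fold-minus ((λ' - d) * v i) (A ∙ v) ⟩
  (λ' - d) * v i - A ∙ v  ∎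
  where
  open ≡-Reasoning
  d = ℕtoℚ (degree G i)
  A = adjacency G i
  unfold-entry : ∀ l e d a x → (l * e - (e * d + a)) * x ≡ (l - d) * (e * x) + (- 1ℚ) * (a * x)
  unfold-entry = solve-∀ ℚ-ring
  fold-minus : ∀ x y → x + (- 1ℚ) * y ≡ x - y
  fold-minus = solve-∀ ℚ-ring

module _ {n₁ n₂} (G₁ : Graph n₁) (G₂ : Graph n₂) where

  adjacency-∨G-↑ˡ : ∀ i → adjacency (G₁ ∨G G₂) (i ↑ˡ n₂) ≗ adjacency G₁ i ++ replicate n₂ 1ℚ
  adjacency-∨G-↑ˡ i k rewrite splitAt-↑ˡ n₁ i n₂ with splitAt n₁ k
  ... | inj₁ _ = refl
  ... | inj₂ _ = refl

  adjacency-∨G-↑ʳ : ∀ j → adjacency (G₁ ∨G G₂) (n₁ ↑ʳ j) ≗ replicate n₁ 1ℚ ++ adjacency G₂ j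
  adjacency-∨G-↑ʳ j k rewrite splitAt-↑ʳ n₁ n₂ j with splitAt n₁ k
  ... | inj₁ _ = refl
  ... | inj₂ _ = refl

module RegularJoin {n₁ n₂ r₁ r₂ : ℕ} (G₁ : Graph n₁) (G₂ : Graph n₂)
                   (reg₁ : Regular G₁ r₁) (reg₂ : Regular G₂ r₂) (λ' : ℚ) where

  N₁ N₂ R₁ R₂ a b num den : ℚ
  N₁ = ℕtoℚ n₁
  N₂ = ℕtoℚ n₂
  R₁ = ℕtoℚ r₁
  R₂ = ℕtoℚ r₂
  a = λ' - N₂ - (R₁ + R₁)
  b = λ' - N₁ - (R₂ + R₂)
  num = a * N₂ + b * N₁ + (N₁ * N₂ + N₁ * N₂)
  den = a * b - N₁ * N₂

  G : Graph (n₁ +ℕ n₂)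
  G = G₁ ∨G G₂

  blocks : ℚ → ℚ → Vector ℚ (n₁ +ℕ n₂)
  blocks p q = replicate n₁ p ++ replicate n₂ q

  replicate≗blocks : ∀ c → replicate (n₁ +ℕ n₂) c ≗ blocks c c
  replicate≗blocks c = ≗-++ {m = n₁} (λ _ → refl) (λ _ → refl)

  sum-blocks : ∀ p q → sum (blocks p q) ≡ N₁ * p + N₂ * q
  sum-blocks p q = trans (sum-↑ n₁ (blocks p q)) (cong₂ _+_
    (trans (sum-cong-≗ (lookup-++ˡ (replicate n₁ p) (replicate n₂ q))) (sum-replicate-ℕtoℚ n₁ p))
    (trans (sum-cong-≗ (lookup-++ʳ (replicate n₁ p) (replicate n₂ q))) (sum-replicate-ℕtoℚ n₂ q)))

  adjacency-blocks-↑ˡ : ∀ i p q → adjacency G (i ↑ˡ n₂) ∙ blocks p q ≡ R₁ * p + N₂ * q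
  adjacency-blocks-↑ˡ i p q = begin
    adjacency G (i ↑ˡ n₂) ∙ blocks p q
      ≡⟨ ∙-congʳ (blocks p q) (adjacency-∨G-↑ˡ G₁ G₂ i) ⟩
    (adjacency G₁ i ++ replicate n₂ 1ℚ) ∙ blocks p q
      ≡⟨ ∙-++ (adjacency G₁ i) (replicate n₁ p) (replicate n₂ 1ℚ) (replicate n₂ q) ⟩
    adjacency G₁ i ∙ replicate n₁ p + replicate n₂ 1ℚ ∙ replicate n₂ q
      ≡⟨ cong₂ _+_ (regular-∙-replicate G₁ reg₁ i p) (ones-∙-replicate n₂ q) ⟩
    R₁ * p + N₂ * q  ∎
    where open ≡-Reasoning

  adjacency-blocks-↑ʳ : ∀ j p q → adjacency G (n₁ ↑ʳ j) ∙ blocks p q ≡ N₁ * p + R₂ * q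
  adjacency-blocks-↑ʳ j p q = begin
    adjacency G (n₁ ↑ʳ j) ∙ blocks p q
      ≡⟨ ∙-congʳ (blocks p q) (adjacency-∨G-↑ʳ G₁ G₂ j) ⟩
    (replicate n₁ 1ℚ ++ adjacency G₂ j) ∙ blocks p q
      ≡⟨ ∙-++ (replicate n₁ 1ℚ) (replicate n₁ p) (adjacency G₂ j) (replicate n₂ q) ⟩
    replicate n₁ 1ℚ ∙ replicate n₁ p + adjacency G₂ j ∙ replicate n₂ q
      ≡⟨ cong₂ _+_ (ones-∙-replicate n₁ p) (regular-∙-replicate G₂ reg₂ j q) ⟩
    N₁ * p + R₂ * q  ∎
    where open ≡-Reasoning

  degree≡∙blocks : ∀ k → ℕtoℚ (degree G k) ≡ adjacency G k ∙ blocks 1ℚ 1ℚ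
  degree≡∙blocks k = trans (degree-∙-ones G k) (∙-congˡ (adjacency G k) (replicate≗blocks 1ℚ))

  degree-↑ˡ : ∀ i → ℕtoℚ (degree G (i ↑ˡ n₂)) ≡ R₁ + N₂
  degree-↑ˡ i = trans (degree≡∙blocks (i ↑ˡ n₂))
    (trans (adjacency-blocks-↑ˡ i 1ℚ 1ℚ) (cong₂ _+_ (*-identityʳ R₁) (*-identityʳ N₂)))

  degree-↑ʳ : ∀ j → ℕtoℚ (degree G (n₁ ↑ʳ j)) ≡ N₁ + R₂
  degree-↑ʳ j = trans (degree≡∙blocks (n₁ ↑ʳ j))
    (trans (adjacency-blocks-↑ʳ j 1ℚ 1ℚ) (cong₂ _+_ (*-identityʳ N₁) (*-identityʳ R₂)))

  shiftedQ-blocks : ∀ p q → shiftedQ G λ' · blocks p q ≗ blocks (a * p - N₂ * q) (b * q - N₁ * p)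
  shiftedQ-blocks p q = ≗-++ {m = n₁} left right
    where
    regroup : ∀ l r m x y → (l - (r + m)) * x - (r * x + m * y) ≡ (l - m - (r + r)) * x - m * y
    regroup = solve-∀ ℚ-ring
    regroup′ : ∀ l r m x y → (l - (m + r)) * x - (m * y + r * x) ≡ (l - m - (r + r)) * x - m * y
    regroup′ = solve-∀ ℚ-ring
    left : ∀ i → (shiftedQ G λ' · blocks p q) (i ↑ˡ n₂) ≡ a * p - N₂ * q
    left i = trans (shiftedQ-· G λ' (blocks p q) (degree-↑ˡ i)
                     (lookup-++ˡ (replicate n₁ p) (replicate n₂ q) i) (adjacency-blocks-↑ˡ i p q))
                   (regroup λ' R₁ N₂ p q)
    right : ∀ j → (shiftedQ G λ' · blocks p q) (n₁ ↑ʳ j) ≡ b * q - N₁ * p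
    right j = trans (shiftedQ-· G λ' (blocks p q) (degree-↑ʳ j)
                      (lookup-++ʳ (replicate n₁ p) (replicate n₂ q) j) (adjacency-blocks-↑ʳ j p q))
                    (regroup′ λ' R₂ N₁ q p)

  shiftedQ-blocks-constant : shiftedQ G λ' · blocks (b + N₂) (a + N₁) ≗ blocks den den
  shiftedQ-blocks-constant k = trans (shiftedQ-blocks (b + N₂) (a + N₁) k)
    (cong₂ (λ x y → blocks x y k) (first a b N₁ N₂) (second a b N₁ N₂))
    where
    first : ∀ x y m n → x * (y + n) - n * (x + m) ≡ x * y - m * n
    first = solve-∀ ℚ-ring
    second : ∀ x y m n → y * (x + m) - m * (y + n) ≡ x * y - m * n
    second = solve-∀ ℚ-ring

  shiftedQ-blocks-zero-on-G₁ : shiftedQ G λ' · blocks N₂ a ≗ blocks 0ℚ den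
  shiftedQ-blocks-zero-on-G₁ k = trans (shiftedQ-blocks N₂ a k)
    (cong₂ (λ x y → blocks x y k) (cancel a N₂) (commute a b N₁ N₂))
    where
    cancel : ∀ x y → x * y - y * x ≡ 0ℚ
    cancel = solve-∀ ℚ-ring
    commute : ∀ x y m n → y * x - m * n ≡ x * y - m * n
    commute = solve-∀ ℚ-ring

  module _ (M : Matrix (n₁ +ℕ n₂)) (M⊗S≡I : ∀ i j → (M ⊗ shiftedQ G λ') i j ≡ identity i j) where

    solves : ∀ {u w} → shiftedQ G λ' · u ≗ w → u ≗ M · w
    solves = inverse-solves {M = M} M⊗S≡I

    den≢0 : Fin n₁ → Fin n₂ → den ≢ 0ℚ
    den≢0 i₁ i₂ den≡0 = ℕtoℚ≢0 i₂ (begin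
      N₂                                ≡⟨ sym (lookup-++ˡ (replicate n₁ N₂) (replicate n₂ a) i₁) ⟩
      blocks N₂ a (i₁ ↑ˡ n₂)            ≡⟨ solves shiftedQ-blocks-zero-on-G₁ (i₁ ↑ˡ n₂) ⟩
      (M · blocks 0ℚ den) (i₁ ↑ˡ n₂)    ≡⟨ ∙-congˡ (M (i₁ ↑ˡ n₂)) blocks[0,den]≗0 ⟩
      (M · replicate _ 0ℚ) (i₁ ↑ˡ n₂)   ≡⟨ ∙-replicate (M (i₁ ↑ˡ n₂)) 0ℚ ⟩
      sum (M (i₁ ↑ˡ n₂)) * 0ℚ           ≡⟨ *-zeroʳ (sum (M (i₁ ↑ˡ n₂))) ⟩
      0ℚ                                ∎)
      where
      open ≡-Reasoning
      blocks[0,den]≗0 : blocks 0ℚ den ≗ replicate (n₁ +ℕ n₂) 0ℚ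
      blocks[0,den]≗0 k = trans (cong (λ d → blocks 0ℚ d k) den≡0) (sym (replicate≗blocks 0ℚ k))

    entrySum-*-den : entrySum M * den ≡ num
    entrySum-*-den = begin
      entrySum M * den                ≡⟨ sym (sum-·-replicate M den) ⟩
      sum (M · replicate _ den)       ≡⟨ sum-cong-≗ (λ i → ∙-congˡ (M i) (replicate≗blocks den)) ⟩
      sum (M · blocks den den)        ≡⟨ sym (sum-cong-≗ (solves shiftedQ-blocks-constant)) ⟩
      sum (blocks (b + N₂) (a + N₁))  ≡⟨ sum-blocks (b + N₂) (a + N₁) ⟩
      N₁ * (b + N₂) + N₂ * (a + N₁)   ≡⟨ expand a b N₁ N₂ ⟩
      num                             ∎
      where
      open ≡-Reasoning
      expand : ∀ x y m n → m * (y + n) + n * (x + m) ≡ x * n + y * m + (m * n + m * n)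
      expand = solve-∀ ℚ-ring

proposition2p13 :
    (n₁ n₂ r₁ r₂ : ℕ) (G₁ : Graph n₁) (G₂ : Graph n₂) →
    Connected G₁ → Regular G₁ r₁ →
    Connected G₂ → Regular G₂ r₂ →
    (λ' : ℚ) (M : Matrix (n₁ +ℕ n₂)) →
    IsInverse M (shiftedQ (G₁ ∨G G₂) λ') →
    let N₁ = ℕtoℚ n₁
        N₂ = ℕtoℚ n₂
        R₁ = ℕtoℚ r₁
        R₂ = ℕtoℚ r₂
        a = λ' - N₂ - (R₁ + R₁)
        b = λ' - N₁ - (R₂ + R₂)
        num = a * N₂ + b * N₁ + (N₁ * N₂ + N₁ * N₂)
        den = a * b - N₁ * N₂
    in (den ≢ 0ℚ) × (entrySum M * den ≡ num)
proposition2p13 n₁ n₂ r₁ r₂ G₁ G₂ (i₁ , _) reg₁ (i₂ , _) reg₂ λ' M (M⊗S≡I , _) =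
  den≢0 M M⊗S≡I i₁ i₂ , entrySum-*-den M M⊗S≡I
  where open RegularJoin G₁ G₂ reg₁ reg₂ λ'
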